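{- Let $r\geq 3$ and let $H$ be an $r$-uniform hypergraph on $n>2r-2$ vertices. If $\delta_1(H)\geq \binom{\lceil n/2\rceil-1}{r-1}+n-1$, then $H$ contains a Hamilton Berge cycle.
   Context: $\delta_1(H)$ is the minimum, over vertices $v$, of the number of hyperedges containing $v$. A Hamilton Berge cycle of a hypergraph on $n$ vertices is an alternating sequence $(v_1,e_1,v_2,\ldots,v_n,e_n)$ of distinct vertices $v_1,\ldots,v_n$ and distinct hyperedges $e_1,\ldots,e_n$ such that $\{v_1,v_n\}\subseteq e_n$ and $\{v_i,v_{i+1}\}\subseteq e_i$ for every $i\in[n-1]$. -}

module Defs where

open import Data.Nat using (ℕ; suc; _+_; _≤_; _<_; _/_)
open import Data.Fin using (Fin; toℕ)
open import Data.Fin.Subset using (Subset; _∈_; ∣_∣)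
open import Data.Vec using (tabulate; lookup; countᵇ)
open import Data.Product using (Σ; _×_)
open import Function.Definitions using (Injective)
open import Relation.Binary.PropositionalEquality using (_≡_)

record Hypergraph (n : ℕ) : Set where
  field
    m        : ℕ
    edge     : Fin m → Subset n
    distinct : Injective _≡_ _≡_ edge
open Hypergraph public

Uniform : ∀ {n} → ℕ → Hypergraph n → Set
Uniform r H = ∀ i → ∣ edge H i ∣ ≡ r

degree : ∀ {n} → Hypergraph n → Fin n → ℕ
degree H v = countᵇ (λ e → lookup e v) (tabulate (edge H))

MinDegreeAtLeast : ∀ {n} → Hypergraph n → ℕ → Set
MinDegreeAtLeast H d = ∀ v → d ≤ degree H v

ceilHalf : ℕ → ℕ
ceilHalf n = (n + 1) / 2

-- Hamilton Berge cycle (v₁,e₁,…,vₙ,eₙ), 0-indexed by positions Fin n: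
-- vtx i = v_{i+1}, edg i = e_{i+1} (an index of a hyperedge of H).
record HamiltonBergeCycle {n : ℕ} (H : Hypergraph n) : Set where
  field
    vtx      : Fin n → Fin n
    edg      : Fin n → Fin (m H)
    vtx-inj  : Injective _≡_ _≡_ vtx
    edg-inj  : Injective _≡_ _≡_ edg
    consec   : ∀ (i j : Fin n) → suc (toℕ i) ≡ toℕ j →
               (vtx i ∈ edge H (edg i)) × (vtx j ∈ edge H (edg i))
    closing  : ∀ (i j : Fin n) → suc (toℕ i) ≡ n → toℕ j ≡ 0 →
               (vtx i ∈ edge H (edg i)) × (vtx j ∈ edge H (edg i))

-- Take a cyclic ordering of all vertices in which some consecutive pairs are joined by
-- pairwise distinct hyperedges (the other pairs are gaps), with as many edges as possible,
-- and suppose it has a gap, rotated to sit between the last vertex b and the first vertex a.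
-- Call the hyperedges not on the cycle fresh, and let N(v) be the set of vertices sharing
-- a fresh hyperedge with v. A fresh hyperedge through a and b would close the gap. For a
-- consecutive pair x, y joined by the link ℓ, if y ∈ N(a) and x ∈ N(b), or y ∈ N(a) and
-- b ∈ ℓ, or a ∈ ℓ and x ∈ N(b), then reversing the segment from y to b and joining x to b
-- and y to a gains an edge. Otherwise counting over the n - 1 pairs gives
--   |N(a)| + |N(b)|,  |N(a)| + d(b),  d(a) + |N(b)|  ≤  n - 1,
-- where d(v) counts the edges on the cycle containing v. The fresh hyperedges through v are
-- distinct (r-1)-subsets of N(v) once v is removed, so deg v ≤ C(|N(v)|, r-1) + d(v), and
-- the degree bound C(⌈n/2⌉-1, r-1) + n - 1 makes these inequalities inconsistent: if
-- |N(a)| < ⌈n/2⌉ then d(a) ≥ n - 1, so N(b) is empty and deg b ≤ n - 1; symmetrically for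
-- b; and |N(a)|, |N(b)| ≥ ⌈n/2⌉ contradicts |N(a)| + |N(b)| ≤ n - 1.
module Submission where

open import Defs
open import Data.Nat using (ℕ; _+_; _*_; _∸_; _≤_; _<_)
open import Data.Nat.Combinatorics using (_C_)

open import Data.Nat using (zero; suc; z≤n; s≤s; _≤′_; ≤′-refl; ≤′-step)
open import Data.Nat.Properties
  using ( ≤-refl; ≤-trans; ≤-reflexive; ≤-pred; module ≤-Reasoning; _≤?_; <⇒≱; ≰⇒>; ≤⇒≤′
        ; suc-injective; n<1+n; n≤1+n; m≤n⇒m≤1+n; m≤m+n; m≤n+m; m≤n+m∸n; n≤0⇒n≡0
        ; +-comm; +-suc; +-identityʳ; +-mono-≤; +-monoˡ-≤; +-monoʳ-≤; +-cancelˡ-≤; +-cancelʳ-≤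
        ; m+n≤o⇒m≤o; m+n≤o⇒n≤o; *-comm; ∸-monoˡ-≤; m+[n∸m]≡n )
open import Data.Nat.Combinatorics using (nCk+nC[k+1]≡[n+1]C[k+1]; k>n⇒nCk≡0)
open import Data.Nat.DivMod using (_/_; _%_; m*n/n≡m; /-monoˡ-≤; m≡m%n+[m/n]*n; m%n<n)
open import Data.Bool using (if_then_else_)
open import Data.Empty using (⊥; ⊥-elim)
open import Data.Unit using (⊤; tt)
open import Data.Product using (Σ; _×_; _,_; proj₁; proj₂)
open import Data.Sum using (_⊎_; inj₁; inj₂)
open import Data.Maybe using (Maybe; just; nothing)
import Data.Maybe.Relation.Unary.Any as Maybe
open import Data.Fin using (Fin; zero; suc; toℕ)
open import Data.Fin.Properties using (toℕ<n; toℕ-injective; any?; _≟_)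
open import Data.Fin.Subset using (Subset; inside; outside; _∈_; _⊆_; ∣_∣; _-_) renaming (⊥ to ∅)
open import Data.Fin.Subset.Properties using (_∈?_; drop-∷-⊆; ∣p∣≤n; p─⊥≡p; p─q⊆p)
import Data.Vec as Vec
open import Data.Vec using (_∷_; []; tail; here; there)
open import Data.Vec.Properties using (∷-injective; lookup∘tabulate; []=⇒lookup; lookup⇒[]=)
import Data.List as List
open import Data.List using (List; []; _∷_; _++_; map; length; allFin; tabulate; catMaybes)
open import Data.List.Properties
  using (map-tabulate; unfold-reverse; length-map; length-tabulate; length-catMaybes; length-++)
open import Data.List.Membership.Propositional using () renaming (_∈_ to _∈ˡ_; _∉_ to _∉ˡ_)
open import Data.List.Relation.Unary.Any using (here; there)
open import Data.List.Relation.Unary.All as All using (All; []; _∷_)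
open import Data.List.Relation.Unary.All.Properties using (¬Any⇒All¬; All¬⇒¬Any)
open import Data.List.Relation.Unary.Unique.Propositional using (Unique; []; _∷_)
open import Data.List.Relation.Unary.Unique.Propositional.Properties using (allFin⁺)
open import Data.List.Relation.Binary.Permutation.Propositional
  using (_↭_; prep; swap; ↭-sym; ↭-reflexive; ↭⇒↭ₛ; module PermutationReasoning)
  renaming (refl to ↭-refl; trans to ↭-trans)
open import Data.List.Relation.Binary.Permutation.Propositional.Properties
  using (↭-length; ++⁺ˡ; shift; ++-comm; ↭-reverse; catMaybes-↭; ∈-resp-↭)
import Data.List.Relation.Binary.Permutation.Setoid.Properties as ↭ₛ
open import Function using (_∘_)
open import Relation.Binary.Definitions using (DecidableEquality)
open import Relation.Binary.PropositionalEquality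
  using (_≡_; _≢_; refl; sym; trans; cong; cong₂; subst; subst₂; setoid; module ≡-Reasoning)
open import Relation.Nullary using (¬_; ¬?; Dec; does; yes; no; contradiction; _×-dec_; _⊎-dec_)
open import Relation.Nullary.Decidable using (dec-true)
open import Relation.Unary using (Pred; Decidable; ∁)
open import Relation.Unary.Properties using (_∩?_; ∁?)

-- Counting

count : ∀ {a p} {A : Set a} {P : Pred A p} → Decidable P → List A → ℕ
count P? []       = 0
count P? (x ∷ xs) = if does (P? x) then suc (count P? xs) else count P? xs

module _ {a p} {A : Set a} {P : Pred A p} (P? : Decidable P) where

  count-++ : ∀ xs ys → count P? (xs ++ ys) ≡ count P? xs + count P? ys
  count-++ []       ys = refl
  count-++ (x ∷ xs) ys with P? x
  ... | yes _ = cong suc (count-++ xs ys)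
  ... | no  _ = count-++ xs ys

  count-↭ : ∀ {xs ys} → xs ↭ ys → count P? xs ≡ count P? ys
  count-↭ ↭-refl           = refl
  count-↭ (prep x xs↭ys)   with P? x
  ... | yes _ = cong suc (count-↭ xs↭ys)
  ... | no  _ = count-↭ xs↭ys
  count-↭ (swap x y xs↭ys) with P? x | P? y
  ... | yes _ | yes _ = cong (λ c → suc (suc c)) (count-↭ xs↭ys)
  ... | yes _ | no  _ = cong suc (count-↭ xs↭ys)
  ... | no  _ | yes _ = cong suc (count-↭ xs↭ys)
  ... | no  _ | no  _ = count-↭ xs↭ys
  count-↭ (↭-trans p q)    = trans (count-↭ p) (count-↭ q)

  count-none : ∀ {xs} → All (∁ P) xs → count P? xs ≡ 0
  count-none []                   = refl
  count-none {x ∷ _} (¬Px ∷ ¬Pxs) with P? x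
  ... | yes Px = contradiction Px ¬Px
  ... | no  _  = count-none ¬Pxs

  count-∷-∉ : ∀ {x} xs → ¬ P x → count P? (x ∷ xs) ≡ count P? xs
  count-∷-∉ {x} _ ¬Px with P? x
  ... | yes Px = contradiction Px ¬Px
  ... | no  _  = refl

  count≤1 : ∀ {xs} → Unique xs → (∀ {x y} → P x → P y → x ≡ y) → count P? xs ≤ 1
  count≤1 []                 _        = z≤n
  count≤1 {x ∷ _} (x∉xs ∷ u) P-unique with P? x
  ... | yes Px = ≤-reflexive (cong suc (count-none (All.map (λ x≢y Py → x≢y (P-unique Px Py)) x∉xs)))
  ... | no  _  = count≤1 u P-unique

  count-split : ∀ {q} {Q : Pred A q} (Q? : Decidable Q) xs →
    count P? xs ≡ count (P? ∩? Q?) xs + count (P? ∩? ∁? Q?) xs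
  count-split Q? []       = refl
  count-split Q? (x ∷ xs) with P? x | Q? x
  ... | no  _ | _     = count-split Q? xs
  ... | yes _ | yes _ = cong suc (count-split Q? xs)
  ... | yes _ | no  _ = trans (cong suc (count-split Q? xs)) (sym (+-suc _ _))

  count-mono : ∀ {q} {Q : Pred A q} (Q? : Decidable Q) → (∀ {x} → P x → Q x) →
    ∀ xs → count P? xs ≤ count Q? xs
  count-mono Q? P⇒Q []       = z≤n
  count-mono Q? P⇒Q (x ∷ xs) with P? x | Q? x
  ... | yes Px | no ¬Qx = contradiction (P⇒Q Px) ¬Qx
  ... | yes _  | yes _  = s≤s (count-mono Q? P⇒Q xs)
  ... | no  _  | yes _  = m≤n⇒m≤1+n (count-mono Q? P⇒Q xs)
  ... | no  _  | no  _  = count-mono Q? P⇒Q xs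

  count-disjoint : ∀ {q} {Q : Pred A q} (Q? : Decidable Q) {xs} → All (λ x → ¬ (P x × Q x)) xs →
    count P? xs + count Q? xs ≤ length xs
  count-disjoint Q? []                      = z≤n
  count-disjoint Q? {x ∷ _} (¬PQx ∷ ¬PQ) with P? x | Q? x
  ... | yes Px | yes Qx = contradiction (Px , Qx) ¬PQx
  ... | yes _  | no  _  = s≤s (count-disjoint Q? ¬PQ)
  ... | no  _  | yes _  = ≤-trans (≤-reflexive (+-suc _ _)) (s≤s (count-disjoint Q? ¬PQ))
  ... | no  _  | no  _  = m≤n⇒m≤1+n (count-disjoint Q? ¬PQ)

count-cong : ∀ {a p q} {A : Set a} {P : Pred A p} {Q : Pred A q} (P? : Decidable P) (Q? : Decidable Q) →
  (∀ x → does (P? x) ≡ does (Q? x)) → ∀ xs → count P? xs ≡ count Q? xs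
count-cong P? Q? same []       = refl
count-cong P? Q? same (x ∷ xs) rewrite same x | count-cong P? Q? same xs = refl

count-map : ∀ {a b p} {A : Set a} {B : Set b} {P : Pred B p} (P? : Decidable P) (f : A → B) xs →
  count P? (map f xs) ≡ count (P? ∘ f) xs
count-map P? f []       = refl
count-map P? f (x ∷ xs) with P? (f x)
... | yes _ = cong suc (count-map P? f xs)
... | no  _ = count-map P? f xs

count-tabulate : ∀ {a p} {A : Set a} {P : Pred A p} (P? : Decidable P) {n} (f : Fin n → A) →
  count P? (tabulate f) ≡ count (P? ∘ f) (allFin n)
count-tabulate P? f = trans (cong (count P?) (sym (map-tabulate (λ i → i) f))) (count-map P? f (allFin _))

count-vec-tabulate : ∀ {a p} {A : Set a} {P : Pred A p} (P? : Decidable P) {n} (f : Fin n → A) →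
  Vec.count P? (Vec.tabulate f) ≡ count (P? ∘ f) (allFin n)
count-vec-tabulate P? {zero}  f = refl
count-vec-tabulate P? {suc n} f with P? (f zero)
... | yes _ = cong suc (trans (count-vec-tabulate P? (f ∘ suc)) (sym (count-tabulate (P? ∘ f) suc)))
... | no  _ = trans (count-vec-tabulate P? (f ∘ suc)) (sym (count-tabulate (P? ∘ f) suc))

count-catMaybes : ∀ {a p} {A : Set a} {P : Pred A p} (P? : Decidable P) ms →
  count P? (catMaybes ms) ≡ count (Maybe.dec P?) ms
count-catMaybes P? []             = refl
count-catMaybes P? (nothing ∷ ms) = count-catMaybes P? ms
count-catMaybes P? (just x ∷ ms)  with P? x
... | yes _ = cong suc (count-catMaybes P? ms)
... | no  _ = count-catMaybes P? ms

module _ {a} {A : Set a} (_≟_ : DecidableEquality A) where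

  open import Data.List.Membership.DecPropositional _≟_ using () renaming (_∈?_ to _∈ˡ?_)

  count-∩-∈≤ : ∀ {p} {P : Pred A p} (P? : Decidable P) {xs} → Unique xs → ∀ U →
    count (P? ∩? (_∈ˡ? U)) xs ≤ count P? U
  count-∩-∈≤ P? {xs} _ [] = ≤-reflexive (count-none (P? ∩? (_∈ˡ? [])) (All.universal (λ _ ()) xs))
  count-∩-∈≤ {P = P} P? {xs} u (v ∷ U) = begin
    count R? xs                                            ≡⟨ count-split R? (_≟ v) xs ⟩
    count (R? ∩? (_≟ v)) xs + count (R? ∩? ∁? (_≟ v)) xs  ≤⟨ +-mono-≤ atV awayFromV ⟩
    count P? (v ∷ []) + count P? U                         ≡⟨ count-++ P? (v ∷ []) U ⟨
    count P? (v ∷ U)                                       ∎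
    where
    open ≤-Reasoning
    R? = P? ∩? (_∈ˡ? v ∷ U)
    atV : count (R? ∩? (_≟ v)) xs ≤ count P? (v ∷ [])
    atV with P? v
    ... | yes _  = count≤1 (R? ∩? (_≟ v)) u (λ (_ , x≡v) (_ , y≡v) → trans x≡v (sym y≡v))
    ... | no ¬Pv = ≤-reflexive (count-none (R? ∩? (_≟ v))
                     (All.universal (λ { _ ((Pv , _) , refl) → ¬Pv Pv }) xs))
    inU : ∀ {x} → (P x × x ∈ˡ v ∷ U) × x ≢ v → P x × x ∈ˡ U
    inU ((_  , here x≡v)  , x≢v) = contradiction x≡v x≢v
    inU ((Px , there x∈U) , _)   = Px , x∈U
    awayFromV : count (R? ∩? ∁? (_≟ v)) xs ≤ count P? U
    awayFromV = ≤-trans (count-mono _ (P? ∩? (_∈ˡ? U)) inU xs) (count-∩-∈≤ P? u U)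

Unique-resp-↭ : ∀ {A : Set} {xs ys : List A} → xs ↭ ys → Unique xs → Unique ys
Unique-resp-↭ {A} xs↭ys = ↭ₛ.Unique-resp-↭ (setoid A) (↭⇒↭ₛ xs↭ys)

Unique-∷-∷ : ∀ {a} {A : Set a} {x y : A} {zs} → Unique (x ∷ zs) → y ∉ˡ x ∷ zs →
  Unique (x ∷ y ∷ zs)
Unique-∷-∷ (x∉zs ∷ u) y∉ =
  ((λ x≡y → y∉ (here (sym x≡y))) ∷ x∉zs) ∷ ¬Any⇒All¬ _ (y∉ ∘ there) ∷ u

module _ {a} {A : Set a} where

  Unique-catMaybes-∷⁻ : ∀ (x : Maybe A) xs → Unique (catMaybes (x ∷ xs)) → Unique (catMaybes xs)
  Unique-catMaybes-∷⁻ nothing  xs u       = u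
  Unique-catMaybes-∷⁻ (just _) xs (_ ∷ u) = u

  ∉-catMaybes-∷⁻ : ∀ {y} (x : Maybe A) xs → y ∉ˡ catMaybes (x ∷ xs) → y ∉ˡ catMaybes xs
  ∉-catMaybes-∷⁻ nothing  xs y∉ = y∉
  ∉-catMaybes-∷⁻ (just _) xs y∉ = y∉ ∘ there

  length-catMaybes-∷ : ∀ (x : Maybe A) xs → length (catMaybes (x ∷ xs)) ≤ suc (length (catMaybes xs))
  length-catMaybes-∷ nothing  xs = n≤1+n _
  length-catMaybes-∷ (just _) xs = ≤-refl

at : ∀ {a} {A : Set a} → A → List A → ℕ → A
at d []       _       = d
at d (x ∷ xs) zero    = x
at d (x ∷ xs) (suc i) = at d xs i

module _ {a} {A : Set a} (d : A) where

  at-∈ : ∀ {xs i} → i < length xs → at d xs i ∈ˡ xs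
  at-∈ {_ ∷ _} {zero}  _         = here refl
  at-∈ {_ ∷ _} {suc i} (s≤s i<) = there (at-∈ i<)

  at-injective : ∀ {xs} → Unique xs → ∀ {i j} → i < length xs → j < length xs →
    at d xs i ≡ at d xs j → i ≡ j
  at-injective (_    ∷ _) {zero}  {zero}  _         _         _  = refl
  at-injective (x∉xs ∷ _) {zero}  {suc j} _         (s≤s j<) eq =
    contradiction (subst (_∈ˡ _) (sym eq) (at-∈ j<)) (All¬⇒¬Any x∉xs)
  at-injective (x∉xs ∷ _) {suc i} {zero}  (s≤s i<) _         eq =
    contradiction (subst (_∈ˡ _) eq (at-∈ i<)) (All¬⇒¬Any x∉xs)
  at-injective (_    ∷ u) {suc i} {suc j} (s≤s i<) (s≤s j<) eq = cong suc (at-injective u i< j< eq)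

  at-++ˡ : ∀ xs {ys i} → i < length xs → at d (xs ++ ys) i ≡ at d xs i
  at-++ˡ (_ ∷ _)  {i = zero}  _         = refl
  at-++ˡ (_ ∷ xs) {i = suc i} (s≤s i<) = at-++ˡ xs i<

  at-++-length : ∀ xs {y ys} → at d (xs ++ y ∷ ys) (length xs) ≡ y
  at-++-length []       = refl
  at-++-length (_ ∷ xs) = at-++-length xs

-- Binomial coefficients

nCk≤[1+n]Ck : ∀ n k → n C k ≤ suc n C k
nCk≤[1+n]Ck n zero    = ≤-refl
nCk≤[1+n]Ck n (suc k) = begin
  n C suc k              ≤⟨ m≤n+m (n C suc k) (n C k) ⟩
  n C k + n C suc k      ≡⟨ nCk+nC[k+1]≡[n+1]C[k+1] n k ⟩
  suc n C suc k          ∎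
  where open ≤-Reasoning

C-monoˡ-≤ : ∀ k {m n} → m ≤ n → m C k ≤ n C k
C-monoˡ-≤ k m≤n = go (≤⇒≤′ m≤n)
  where
  go : ∀ {m n} → m ≤′ n → m C k ≤ n C k
  go ≤′-refl        = ≤-refl
  go (≤′-step m≤′n) = ≤-trans (go m≤′n) (nCk≤[1+n]Ck _ k)

k≤n⇒0<nCk : ∀ {n k} → k ≤ n → 0 < n C k
k≤n⇒0<nCk {k = zero}      _         = s≤s z≤n
k≤n⇒0<nCk {suc n} {suc k} (s≤s k≤n) = begin-strict
  0                      <⟨ k≤n⇒0<nCk k≤n ⟩
  n C k                  ≤⟨ m≤m+n (n C k) (n C suc k) ⟩
  n C k + n C suc k      ≡⟨ nCk+nC[k+1]≡[n+1]C[k+1] n k ⟩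
  suc n C suc k          ∎
  where open ≤-Reasoning

lookup≡does-∈? : ∀ {n} (p : Subset n) x → Vec.lookup p x ≡ does (x ∈? p)
lookup≡does-∈? (inside  ∷ p) zero    = refl
lookup≡does-∈? (outside ∷ p) zero    = refl
lookup≡does-∈? (_       ∷ p) (suc x) = lookup≡does-∈? p x

count-∈?-allFin : ∀ {n} (p : Subset n) → count (_∈? p) (allFin n) ≡ ∣ p ∣

count-∈?-tabulate-suc : ∀ {n b} (p : Subset n) → count (_∈? b ∷ p) (tabulate suc) ≡ ∣ p ∣
count-∈?-tabulate-suc {b = b} p = begin
  count (_∈? b ∷ p) (tabulate suc)       ≡⟨ count-tabulate (_∈? b ∷ p) suc ⟩
  count ((_∈? b ∷ p) ∘ suc) (allFin _)   ≡⟨ count-cong _ (_∈? p) (λ _ → refl) (allFin _) ⟩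
  count (_∈? p) (allFin _)               ≡⟨ count-∈?-allFin p ⟩
  ∣ p ∣                                  ∎
  where open ≡-Reasoning

count-∈?-allFin []            = refl
count-∈?-allFin (inside ∷ p)  = cong suc (count-∈?-tabulate-suc p)
count-∈?-allFin (outside ∷ p) = count-∈?-tabulate-suc p

fromDec : ∀ {n p} {P : Pred (Fin n) p} → Decidable P → Subset n
fromDec P? = Vec.tabulate (does ∘ P?)

∈-fromDec⁻ : ∀ {n p} {P : Pred (Fin n) p} (P? : Decidable P) {x} → x ∈ fromDec P? → P x
∈-fromDec⁻ P? {x} x∈ with P? x | trans (sym (lookup∘tabulate (does ∘ P?) x)) ([]=⇒lookup x∈)
... | yes Px | _ = Px

∈-fromDec⁺ : ∀ {n p} {P : Pred (Fin n) p} (P? : Decidable P) {x} → P x → x ∈ fromDec P?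
∈-fromDec⁺ P? {x} Px = lookup⇒[]= x _ (trans (lookup∘tabulate (does ∘ P?) x) (dec-true (P? x) Px))

∈-tail-sized : ∀ {n k b} {p : Subset (suc n)} {T} → zero ∈ p →
  ∣ p ∣ ≡ suc k × p ⊆ b ∷ T → ∣ tail p ∣ ≡ k × tail p ⊆ T
∈-tail-sized here (size , p⊆) = suc-injective size , drop-∷-⊆ p⊆

∉-tail-sized : ∀ {n k b} {p : Subset (suc n)} {T} → ¬ zero ∈ p →
  ∣ p ∣ ≡ k × p ⊆ b ∷ T → ∣ tail p ∣ ≡ k × tail p ⊆ T
∉-tail-sized {p = inside  ∷ _} zero∉p _          = contradiction here zero∉p
∉-tail-sized {p = outside ∷ _} _      (size , p⊆) = size , drop-∷-⊆ p⊆

∈-tail-injective : ∀ {n} {p q : Subset (suc n)} → zero ∈ p → zero ∈ q → tail p ≡ tail q → p ≡ q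
∈-tail-injective here here refl = refl

∉-tail-injective : ∀ {n} {p q : Subset (suc n)} → ¬ zero ∈ p → ¬ zero ∈ q →
  tail p ≡ tail q → p ≡ q
∉-tail-injective {p = outside ∷ _} {outside ∷ _} _      _      refl = refl
∉-tail-injective {p = inside  ∷ _}               zero∉p _      _    = contradiction here zero∉p
∉-tail-injective {q = inside  ∷ _}               _      zero∉q _    = contradiction here zero∉q

∣p∣≡0⇒p≡∅ : ∀ {n} {p : Subset n} → ∣ p ∣ ≡ 0 → p ≡ ∅
∣p∣≡0⇒p≡∅ {p = []}          _  = refl
∣p∣≡0⇒p≡∅ {p = outside ∷ p} eq = cong (outside ∷_) (∣p∣≡0⇒p≡∅ eq)

x∉p-x : ∀ {n} (x : Fin n) (p : Subset n) → ¬ x ∈ p - x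
x∉p-x zero    (_ ∷ p) ()
x∉p-x (suc x) (_ ∷ p) (there x∈p-x) = x∉p-x x p x∈p-x

x∈p⇒∣p∣≡1+∣p-x∣ : ∀ {n} {x : Fin n} {p} → x ∈ p → ∣ p ∣ ≡ suc ∣ p - x ∣
x∈p⇒∣p∣≡1+∣p-x∣ {p = inside  ∷ p} here        = cong suc (cong ∣_∣ (sym (p─⊥≡p p)))
x∈p⇒∣p∣≡1+∣p-x∣ {p = inside  ∷ p} (there x∈p) = cong suc (x∈p⇒∣p∣≡1+∣p-x∣ x∈p)
x∈p⇒∣p∣≡1+∣p-x∣ {p = outside ∷ p} (there x∈p) = x∈p⇒∣p∣≡1+∣p-x∣ x∈p

-x-injective : ∀ {n} {x : Fin n} {p q} → x ∈ p → x ∈ q → p - x ≡ q - x → p ≡ q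
-x-injective {p = _ ∷ p} {_ ∷ q} here here eq =
  cong (inside ∷_) (trans (sym (p─⊥≡p p)) (trans (proj₂ (∷-injective eq)) (p─⊥≡p q)))
-x-injective (there x∈p) (there x∈q) eq with ∷-injective eq
... | b≡c , p-x≡q-x = cong₂ _∷_ b≡c (-x-injective x∈p x∈q p-x≡q-x)

count-subsets≤C : ∀ {x s} {X : Set x} {S : Pred X s} (S? : Decidable S) {n} (E : X → Subset n) T k →
  ∀ {xs} → Unique xs → (∀ {x y} → S x → S y → E x ≡ E y → x ≡ y) →
  (∀ {x} → S x → ∣ E x ∣ ≡ k × E x ⊆ T) → count S? xs ≤ ∣ T ∣ C k
count-subsets≤C {S = S} S? E T zero u inj sized =
  count≤1 S? u (λ Sx Sy → inj Sx Sy (trans (empty Sx) (sym (empty Sy))))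
  where
  empty : ∀ {x} → S x → E x ≡ ∅
  empty Sx = ∣p∣≡0⇒p≡∅ (proj₁ (sized Sx))
count-subsets≤C {S = S} S? E [] (suc k) {xs} _ _ sized =
  ≤-reflexive (count-none S? (All.universal tooLarge xs))
  where
  tooLarge : ∀ x → ¬ S x
  tooLarge x Sx = <⇒≱ (s≤s z≤n) (subst (_≤ 0) (proj₁ (sized Sx)) (∣p∣≤n (E x)))
count-subsets≤C {S = S} S? E (outside ∷ T) (suc k) {xs} u inj sized = begin
  count S? xs                                      ≡⟨ count-split S? In? xs ⟩
  count (S? ∩? In?) xs + count (S? ∩? ∁? In?) xs   ≡⟨ cong (_+ count (S? ∩? ∁? In?) xs) withZero ⟩
  count (S? ∩? ∁? In?) xs                          ≤⟨ withoutZero ⟩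
  ∣ T ∣ C suc k                                    ∎
  where
  open ≤-Reasoning
  In? : Decidable (λ x → zero ∈ E x)
  In? x = zero ∈? E x
  zeroOutside : ∀ x → ¬ (S x × zero ∈ E x)
  zeroOutside x (Sx , zero∈) with proj₂ (sized Sx) zero∈
  ... | ()
  withZero : count (S? ∩? In?) xs ≡ 0
  withZero = count-none (S? ∩? In?) (All.universal zeroOutside xs)
  withoutZero : count (S? ∩? ∁? In?) xs ≤ ∣ T ∣ C suc k
  withoutZero = count-subsets≤C (S? ∩? ∁? In?) (tail ∘ E) T (suc k) u
    (λ (Sx , x∉) (Sy , y∉) eq → inj Sx Sy (∉-tail-injective x∉ y∉ eq))
    (λ (Sx , x∉) → ∉-tail-sized x∉ (sized Sx))
count-subsets≤C {S = S} S? E (inside ∷ T) (suc k) {xs} u inj sized = begin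
  count S? xs                                      ≡⟨ count-split S? In? xs ⟩
  count (S? ∩? In?) xs + count (S? ∩? ∁? In?) xs   ≤⟨ +-mono-≤ withZero withoutZero ⟩
  ∣ T ∣ C k + ∣ T ∣ C suc k                        ≡⟨ nCk+nC[k+1]≡[n+1]C[k+1] ∣ T ∣ k ⟩
  suc ∣ T ∣ C suc k                                ∎
  where
  open ≤-Reasoning
  In? : Decidable (λ x → zero ∈ E x)
  In? x = zero ∈? E x
  withZero : count (S? ∩? In?) xs ≤ ∣ T ∣ C k
  withZero = count-subsets≤C (S? ∩? In?) (tail ∘ E) T k u
    (λ (Sx , x∈) (Sy , y∈) eq → inj Sx Sy (∈-tail-injective x∈ y∈ eq))
    (λ (Sx , x∈) → ∈-tail-sized x∈ (sized Sx))
  withoutZero : count (S? ∩? ∁? In?) xs ≤ ∣ T ∣ C suc k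
  withoutZero = count-subsets≤C (S? ∩? ∁? In?) (tail ∘ E) T (suc k) u
    (λ (Sx , x∉) (Sy , y∉) eq → inj Sx Sy (∉-tail-injective x∉ y∉ eq))
    (λ (Sx , x∉) → ∉-tail-sized x∉ (sized Sx))

count-subsets-through≤C : ∀ {x s} {X : Set x} {S : Pred X s} (S? : Decidable S) {n} (E : X → Subset n) v T k →
  ∀ {xs} → Unique xs → (∀ {x y} → S x → S y → E x ≡ E y → x ≡ y) →
  (∀ {x} → S x → ∣ E x ∣ ≡ suc k × v ∈ E x × E x - v ⊆ T) → count S? xs ≤ ∣ T ∣ C k
count-subsets-through≤C {S = S} S? E v T k u inj through = count-subsets≤C S? (λ x → E x - v) T k u
  (λ Sx Sy eq → inj Sx Sy (-x-injective (v∈ Sx) (v∈ Sy) eq))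
  (λ Sx → let (size , v∈E , E-v⊆T) = through Sx in
    suc-injective (trans (sym (x∈p⇒∣p∣≡1+∣p-x∣ v∈E)) size) , E-v⊆T)
  where
  v∈ : ∀ {x} → S x → v ∈ E x
  v∈ Sx = proj₁ (proj₂ (through Sx))

small-side-contradiction : ∀ {k c l α β dα dβ} → 0 < k → 0 < c C k → α ≤ c →
  c C k + l ≤ α C k + dα → c C k + l ≤ β C k + dβ → dα + β ≤ l → dβ ≤ l → ⊥
small-side-contradiction {k} {c} {l} {α} {β} {dα} {dβ} 0<k 0<cCk α≤c degα degβ dα+β≤l dβ≤l =
  <⇒≱ 0<cCk (+-cancelʳ-≤ l (c C k) 0 (begin
    c C k + l   ≤⟨ degβ ⟩
    β C k + dβ  ≡⟨ cong (λ b → b C k + dβ) β≡0 ⟩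
    0 C k + dβ  ≡⟨ cong (_+ dβ) (k>n⇒nCk≡0 0<k) ⟩
    dβ          ≤⟨ dβ≤l ⟩
    l           ∎))
  where
  open ≤-Reasoning
  l≤dα : l ≤ dα
  l≤dα = +-cancelˡ-≤ (c C k) l dα (≤-trans degα (+-monoˡ-≤ dα (C-monoˡ-≤ k α≤c)))
  β≡0 : β ≡ 0
  β≡0 = n≤0⇒n≡0 (+-cancelˡ-≤ dα β 0 (≤-trans dα+β≤l
    (subst (l ≤_) (sym (+-identityʳ dα)) l≤dα)))

two-degrees-contradiction : ∀ {k c l α β dα dβ} → 0 < k → 0 < c C k → l < 2 * suc c →
  c C k + l ≤ α C k + dα → c C k + l ≤ β C k + dβ →
  α + β ≤ l → α + dβ ≤ l → dα + β ≤ l → ⊥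
two-degrees-contradiction {c = c} {l} {α} {β} {dα} {dβ} 0<k 0<cCk l<2[1+c] degα degβ
  α+β≤l α+dβ≤l dα+β≤l with α ≤? c | β ≤? c
... | yes α≤c | _       =
  small-side-contradiction 0<k 0<cCk α≤c degα degβ dα+β≤l (m+n≤o⇒n≤o α α+dβ≤l)
... | no  _   | yes β≤c =
  small-side-contradiction 0<k 0<cCk β≤c degβ degα
    (subst (_≤ l) (+-comm α dβ) α+dβ≤l) (m+n≤o⇒m≤o dα dα+β≤l)
... | no  α≰c | no  β≰c = <⇒≱ l<2[1+c] (begin
  2 * suc c      ≡⟨ cong (suc c +_) (+-identityʳ (suc c)) ⟩
  suc c + suc c  ≤⟨ +-mono-≤ (≰⇒> α≰c) (≰⇒> β≰c) ⟩
  α + β          ≤⟨ α+β≤l ⟩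
  l              ∎)
  where open ≤-Reasoning

2r∸2<n⇒r≤⌈n/2⌉ : ∀ {r n} → 2 * r ∸ 2 < n → r ≤ ceilHalf n
2r∸2<n⇒r≤⌈n/2⌉ {r} {n} 2r∸2<n = begin
  r            ≡⟨ m*n/n≡m r 2 ⟨
  r * 2 / 2    ≤⟨ /-monoˡ-≤ 2 r*2≤n+1 ⟩
  (n + 1) / 2  ∎
  where
  open ≤-Reasoning
  r*2≤n+1 : r * 2 ≤ n + 1
  r*2≤n+1 = begin
    r * 2            ≡⟨ *-comm r 2 ⟩
    2 * r            ≤⟨ m≤n+m∸n (2 * r) 2 ⟩
    2 + (2 * r ∸ 2)  ≤⟨ s≤s 2r∸2<n ⟩
    suc n            ≡⟨ +-comm 1 n ⟩
    n + 1            ∎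

n≤2⌈n/2⌉ : ∀ n → n ≤ 2 * ceilHalf n
n≤2⌈n/2⌉ n = +-cancelˡ-≤ 1 n _ (begin
  1 + n                         ≡⟨ +-comm 1 n ⟩
  n + 1                         ≡⟨ m≡m%n+[m/n]*n (n + 1) 2 ⟩
  (n + 1) % 2 + ceilHalf n * 2  ≤⟨ +-monoˡ-≤ _ (≤-pred (m%n<n (n + 1) 2)) ⟩
  1 + ceilHalf n * 2            ≡⟨ cong (1 +_) (*-comm (ceilHalf n) 2) ⟩
  1 + 2 * ceilHalf n            ∎)
  where open ≤-Reasoning

-- Berge paths

module Arrangements {n : ℕ} (H : Hypergraph n) where

  open import Data.List.Membership.DecPropositional (_≟_ {m H}) using () renaming (_∈?_ to _∈ˡ?_)

  Vertex : Set
  Vertex = Fin n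

  Edge : Set
  Edge = Fin (m H)

  -- A link between consecutive vertices: a hyperedge containing both, or a gap.
  Joins : Maybe Edge → Vertex → Vertex → Set
  Joins nothing  _ _ = ⊤
  Joins (just e) u v = u ∈ edge H e × v ∈ edge H e

  Joins-sym : ∀ ℓ {u v} → Joins ℓ u v → Joins ℓ v u
  Joins-sym nothing  _         = tt
  Joins-sym (just e) (u∈ , v∈) = v∈ , u∈

  infixr 5 _∷⟨_,_⟩_

  data Path : Vertex → Vertex → Set where
    [_]      : ∀ v → Path v v
    _∷⟨_,_⟩_ : ∀ u {v w} (ℓ : Maybe Edge) → Joins ℓ u v → Path v w → Path u w

  record Step : Set where
    constructor step
    field
      source : Vertex
      via    : Maybe Edge
      target : Vertex
  open Step public

  private
    variable
      a b x y : Vertex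

  vertices : Path a b → List Vertex
  vertices [ v ]            = v ∷ []
  vertices (u ∷⟨ _ , _ ⟩ p) = u ∷ vertices p

  links : Path a b → List (Maybe Edge)
  links [ _ ]            = []
  links (_ ∷⟨ ℓ , _ ⟩ p) = ℓ ∷ links p

  pathEdges : Path a b → List Edge
  pathEdges p = catMaybes (links p)

  steps : Path a b → List Step
  steps [ _ ]                  = []
  steps (_∷⟨_,_⟩_ u {v} ℓ _ p) = step u ℓ v ∷ steps p

  _++⟨_,_⟩_ : Path a x → (ℓ : Maybe Edge) → Joins ℓ x y → Path y b → Path a b
  [ x ]              ++⟨ ℓ , j ⟩ q = x ∷⟨ ℓ , j ⟩ q
  (u ∷⟨ ℓ′ , j′ ⟩ p) ++⟨ ℓ , j ⟩ q = u ∷⟨ ℓ′ , j′ ⟩ (p ++⟨ ℓ , j ⟩ q)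

  reverse : Path a b → Path b a
  reverse [ v ]            = [ v ]
  reverse (u ∷⟨ ℓ , j ⟩ p) = reverse p ++⟨ ℓ , Joins-sym ℓ j ⟩ [ u ]

  vertices-++ : ∀ (p : Path a x) ℓ j (q : Path y b) →
    vertices (p ++⟨ ℓ , j ⟩ q) ≡ vertices p ++ vertices q
  vertices-++ [ _ ]            ℓ j q = refl
  vertices-++ (u ∷⟨ _ , _ ⟩ p) ℓ j q = cong (u ∷_) (vertices-++ p ℓ j q)

  links-++ : ∀ (p : Path a x) ℓ j (q : Path y b) →
    links (p ++⟨ ℓ , j ⟩ q) ≡ links p ++ ℓ ∷ links q
  links-++ [ _ ]             ℓ j q = refl
  links-++ (_ ∷⟨ ℓ′ , _ ⟩ p) ℓ j q = cong (ℓ′ ∷_) (links-++ p ℓ j q)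

  vertices-reverse : ∀ (p : Path a b) → vertices (reverse p) ≡ List.reverse (vertices p)
  vertices-reverse [ _ ]            = refl
  vertices-reverse (u ∷⟨ ℓ , j ⟩ p) = begin
    vertices (reverse p ++⟨ ℓ , Joins-sym ℓ j ⟩ [ u ])  ≡⟨ vertices-++ (reverse p) ℓ _ [ u ] ⟩
    vertices (reverse p) ++ u ∷ []                      ≡⟨ cong (_++ u ∷ []) (vertices-reverse p) ⟩
    List.reverse (vertices p) ++ u ∷ []                 ≡⟨ unfold-reverse u (vertices p) ⟨
    List.reverse (u ∷ vertices p)                       ∎
    where open ≡-Reasoning

  links-reverse : ∀ (p : Path a b) → links (reverse p) ≡ List.reverse (links p)
  links-reverse [ _ ]            = refl
  links-reverse (u ∷⟨ ℓ , j ⟩ p) = begin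
    links (reverse p ++⟨ ℓ , Joins-sym ℓ j ⟩ [ u ])  ≡⟨ links-++ (reverse p) ℓ _ [ u ] ⟩
    links (reverse p) ++ ℓ ∷ []                      ≡⟨ cong (_++ ℓ ∷ []) (links-reverse p) ⟩
    List.reverse (links p) ++ ℓ ∷ []                 ≡⟨ unfold-reverse ℓ (links p) ⟨
    List.reverse (ℓ ∷ links p)                       ∎
    where open ≡-Reasoning

  vertices≡start∷targets : ∀ (p : Path a b) → vertices p ≡ a ∷ map target (steps p)
  vertices≡start∷targets [ _ ]            = refl
  vertices≡start∷targets (u ∷⟨ _ , _ ⟩ p) = cong (u ∷_) (vertices≡start∷targets p)

  vertices≡sources∷ʳend : ∀ (p : Path a b) → vertices p ≡ map source (steps p) ++ b ∷ []
  vertices≡sources∷ʳend [ _ ]            = refl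
  vertices≡sources∷ʳend (u ∷⟨ _ , _ ⟩ p) = cong (u ∷_) (vertices≡sources∷ʳend p)

  links≡vias : ∀ (p : Path a b) → links p ≡ map via (steps p)
  links≡vias [ _ ]            = refl
  links≡vias (_ ∷⟨ ℓ , _ ⟩ p) = cong (ℓ ∷_) (links≡vias p)

  data Found {q} (Q : Pred Step q) {a b} : Path a b → Set q where
    found : ∀ {x y} (A : Path a x) ℓ (j : Joins ℓ x y) (B : Path y b) →
      Q (step x ℓ y) → Found Q (A ++⟨ ℓ , j ⟩ B)

  findStep : ∀ {q} {Q : Pred Step q} → Decidable Q → (p : Path a b) → Found Q p ⊎ All (∁ Q) (steps p)
  findStep Q? [ _ ] = inj₂ []
  findStep Q? (_∷⟨_,_⟩_ u {v} ℓ j p) with Q? (step u ℓ v)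
  ... | yes q = inj₁ (found [ u ] ℓ j p q)
  ... | no ¬q with findStep Q? p
  ...   | inj₂ none                = inj₂ (¬q ∷ none)
  ...   | inj₁ (found A ℓ′ j′ B q) = inj₁ (found (u ∷⟨ ℓ , j ⟩ A) ℓ′ j′ B q)

  Spanning : Path a b → Set
  Spanning p = vertices p ↭ allFin n

  length-steps : ∀ (p : Path a b) → Spanning p → suc (length (steps p)) ≡ n
  length-steps {a} p sp = begin
    suc (length (steps p))             ≡⟨ cong suc (length-map target (steps p)) ⟨
    length (a ∷ map target (steps p))  ≡⟨ cong length (vertices≡start∷targets p) ⟨
    length (vertices p)                ≡⟨ ↭-length sp ⟩
    length (allFin n)                  ≡⟨ length-tabulate (λ i → i) ⟩
    n                                  ∎
    where open ≡-Reasoning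

  count-targets : ∀ (p : Path a b) → Spanning p → ∀ T → ¬ a ∈ T →
    count ((_∈? T) ∘ target) (steps p) ≡ ∣ T ∣
  count-targets {a} p sp T a∉T = begin
    count ((_∈? T) ∘ target) (steps p)        ≡⟨ count-map (_∈? T) target (steps p) ⟨
    count (_∈? T) (map target (steps p))      ≡⟨ count-∷-∉ (_∈? T) (map target (steps p)) a∉T ⟨
    count (_∈? T) (a ∷ map target (steps p))  ≡⟨ cong (count (_∈? T)) (vertices≡start∷targets p) ⟨
    count (_∈? T) (vertices p)                ≡⟨ count-↭ (_∈? T) sp ⟩
    count (_∈? T) (allFin n)                  ≡⟨ count-∈?-allFin T ⟩
    ∣ T ∣                                     ∎
    where open ≡-Reasoning

  count-sources : ∀ (p : Path a b) → Spanning p → ∀ T → ¬ b ∈ T →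
    count ((_∈? T) ∘ source) (steps p) ≡ ∣ T ∣
  count-sources {b = b} p sp T b∉T = begin
    count ((_∈? T) ∘ source) (steps p)             ≡⟨ count-map (_∈? T) source (steps p) ⟨
    count (_∈? T) sources                          ≡⟨ +-identityʳ _ ⟨
    count (_∈? T) sources + 0                      ≡⟨ cong (count (_∈? T) sources +_) b∉ ⟨
    count (_∈? T) sources + count (_∈? T) (b ∷ []) ≡⟨ count-++ (_∈? T) sources (b ∷ []) ⟨
    count (_∈? T) (sources ++ b ∷ [])              ≡⟨ cong (count (_∈? T)) (vertices≡sources∷ʳend p) ⟨
    count (_∈? T) (vertices p)                     ≡⟨ count-↭ (_∈? T) sp ⟩
    count (_∈? T) (allFin n)                       ≡⟨ count-∈?-allFin T ⟩
    ∣ T ∣                                          ∎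
    where
    open ≡-Reasoning
    sources = map source (steps p)
    b∉ = count-∷-∉ (_∈? T) [] b∉T

  count-pathEdges : ∀ {q} {Q : Pred Edge q} (Q? : Decidable Q) (p : Path a b) →
    count Q? (pathEdges p) ≡ count (Maybe.dec Q? ∘ via) (steps p)
  count-pathEdges Q? p = begin
    count Q? (catMaybes (links p))            ≡⟨ count-catMaybes Q? (links p) ⟩
    count (Maybe.dec Q?) (links p)            ≡⟨ cong (count (Maybe.dec Q?)) (links≡vias p) ⟩
    count (Maybe.dec Q?) (map via (steps p))  ≡⟨ count-map (Maybe.dec Q?) via (steps p) ⟩
    count (Maybe.dec Q? ∘ via) (steps p)      ∎
    where open ≡-Reasoning

  degree≡count : ∀ v → degree H v ≡ count (λ e → v ∈? edge H e) (allFin (m H))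
  degree≡count v = trans (count-vec-tabulate _ (edge H))
    (count-cong _ _ (λ e → lookup≡does-∈? (edge H e) v) (allFin (m H)))

  -- Cyclic arrangements

  usedEdges : Path a b → Maybe Edge → List Edge
  usedEdges p closing = catMaybes (closing ∷ links p)

  -- The cyclic ordering of all vertices along path, closed up by the link from last back to first.
  record Arrangement : Set where
    constructor arrangement
    field
      {first last} : Vertex
      path         : Path first last
      closing      : Maybe Edge
      closes       : Joins closing last first
      spanning     : Spanning path
      distinct     : Unique (usedEdges path closing)

    size : ℕ
    size = length (usedEdges path closing)

  open Arrangement public

  size≤n : ∀ s → size s ≤ n
  size≤n (arrangement p closing _ sp _) = begin
    length (catMaybes (closing ∷ links p))  ≤⟨ length-catMaybes (closing ∷ links p) ⟩
    suc (length (links p))                  ≡⟨ cong (suc ∘ length) (links≡vias p) ⟩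
    suc (length (map via (steps p)))        ≡⟨ cong suc (length-map via (steps p)) ⟩
    suc (length (steps p))                  ≡⟨ length-steps p sp ⟩
    n                                       ∎
    where open ≤-Reasoning

  LargerThan : ℕ → Set
  LargerThan k = Σ Arrangement (λ s → k < size s)

  pathEdges-split : ∀ (A : Path a x) ℓ j (B : Path y b) →
    pathEdges (A ++⟨ ℓ , j ⟩ B) ↭ catMaybes (ℓ ∷ links A ++ links B)
  pathEdges-split A ℓ j B =
    catMaybes-↭ (↭-trans (↭-reflexive (links-++ A ℓ j B)) (shift ℓ (links A) (links B)))

  pathEdges-rotate : ∀ (A : Path a x) (B : Path y b) {e} (je : Joins (just e) b a) →
    pathEdges (B ++⟨ just e , je ⟩ A) ↭ usedEdges (A ++⟨ nothing , tt ⟩ B) (just e)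
  pathEdges-rotate A B {e} je = catMaybes-↭ (begin
    nothing ∷ links (B ++⟨ just e , je ⟩ A)  ≡⟨ cong (nothing ∷_) (links-++ B (just e) je A) ⟩
    (nothing ∷ links B) ++ just e ∷ links A  ↭⟨ ++-comm (nothing ∷ links B) (just e ∷ links A) ⟩
    (just e ∷ links A) ++ nothing ∷ links B  ≡⟨ cong (just e ∷_) (links-++ A nothing tt B) ⟨
    just e ∷ links (A ++⟨ nothing , tt ⟩ B)  ∎)
    where open PermutationReasoning

  vertices-rotate : ∀ (A : Path a x) ℓ j (B : Path y b) ℓ′ j′ →
    vertices (B ++⟨ ℓ′ , j′ ⟩ A) ↭ vertices (A ++⟨ ℓ , j ⟩ B)
  vertices-rotate A ℓ j B ℓ′ j′ = begin
    vertices (B ++⟨ ℓ′ , j′ ⟩ A)  ≡⟨ vertices-++ B ℓ′ j′ A ⟩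
    vertices B ++ vertices A      ↭⟨ ++-comm (vertices B) (vertices A) ⟩
    vertices A ++ vertices B      ≡⟨ vertices-++ A ℓ j B ⟨
    vertices (A ++⟨ ℓ , j ⟩ B)    ∎
    where open PermutationReasoning

  vertices-reroute : ∀ (A : Path a x) ℓ j (B : Path y b) ℓ′ j′ →
    vertices (A ++⟨ ℓ′ , j′ ⟩ reverse B) ↭ vertices (A ++⟨ ℓ , j ⟩ B)
  vertices-reroute A ℓ j B ℓ′ j′ = begin
    vertices (A ++⟨ ℓ′ , j′ ⟩ reverse B)     ≡⟨ vertices-++ A ℓ′ j′ (reverse B) ⟩
    vertices A ++ vertices (reverse B)       ≡⟨ cong (vertices A ++_) (vertices-reverse B) ⟩
    vertices A ++ List.reverse (vertices B)  ↭⟨ ++⁺ˡ (vertices A) (↭-reverse (vertices B)) ⟩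
    vertices A ++ vertices B                 ≡⟨ vertices-++ A ℓ j B ⟨
    vertices (A ++⟨ ℓ , j ⟩ B)               ∎
    where open PermutationReasoning

  usedEdges-reroute : ∀ (A : Path a x) (B : Path y b) {f g} (jg : Joins (just g) x b) →
    usedEdges (A ++⟨ just g , jg ⟩ reverse B) (just f) ↭ f ∷ g ∷ catMaybes (links A ++ links B)
  usedEdges-reroute A B {f} {g} jg = prep f (catMaybes-↭ (begin
    links (A ++⟨ just g , jg ⟩ reverse B)       ≡⟨ links-++ A (just g) jg (reverse B) ⟩
    links A ++ just g ∷ links (reverse B)       ≡⟨ cong (λ ls → links A ++ just g ∷ ls) (links-reverse B) ⟩
    links A ++ just g ∷ List.reverse (links B)  ↭⟨ shift (just g) (links A) (List.reverse (links B)) ⟩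
    just g ∷ links A ++ List.reverse (links B)  ↭⟨ prep (just g) (++⁺ˡ (links A) (↭-reverse (links B))) ⟩
    just g ∷ links A ++ links B                 ∎))
    where open PermutationReasoning

  closeGap : ∀ (p : Path a b) → Spanning p → Unique (pathEdges p) →
    ∀ {f} → f ∉ˡ pathEdges p → a ∈ edge H f → b ∈ edge H f → LargerThan (length (pathEdges p))
  closeGap p sp u f∉ a∈f b∈f =
    arrangement p (just _) (b∈f , a∈f) sp (¬Any⇒All¬ _ f∉ ∷ u) , ≤-refl

  reroute : ∀ (A : Path a x) ℓ j (B : Path y b) → Spanning (A ++⟨ ℓ , j ⟩ B) →
    ∀ {f g} → y ∈ edge H f → a ∈ edge H f → x ∈ edge H g → b ∈ edge H g →
    Unique (f ∷ g ∷ catMaybes (links A ++ links B)) → LargerThan (length (pathEdges (A ++⟨ ℓ , j ⟩ B)))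
  reroute A ℓ j B sp {f} {g} y∈f a∈f x∈g b∈g u =
    arrangement (A ++⟨ just g , (x∈g , b∈g) ⟩ reverse B) (just f) (y∈f , a∈f)
      (↭-trans (vertices-reroute A ℓ j B (just g) _) sp) (Unique-resp-↭ (↭-sym new↭) u) ,
    (begin-strict
      length (pathEdges (A ++⟨ ℓ , j ⟩ B))  ≡⟨ ↭-length (pathEdges-split A ℓ j B) ⟩
      length (catMaybes (ℓ ∷ R))            ≤⟨ length-catMaybes-∷ ℓ R ⟩
      suc (length (catMaybes R))            <⟨ n<1+n _ ⟩
      length (f ∷ g ∷ catMaybes R)          ≡⟨ ↭-length new↭ ⟨
      length (usedEdges (A ++⟨ just g , _ ⟩ reverse B) (just f))  ∎)
    where
    open ≤-Reasoning
    R = links A ++ links B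
    new↭ = usedEdges-reroute A B {f} (x∈g , b∈g)

  HasGap : Pred Step _
  HasGap t = via t ≡ nothing

  hasGap? : Decidable HasGap
  hasGap? (step _ nothing  _) = yes refl
  hasGap? (step _ (just _) _) = no λ ()

  data Linked : List Vertex → List Edge → Set where
    [_] : ∀ v → Linked (v ∷ []) []
    _∷_ : ∀ {u v vs e es} → Joins (just e) u v → Linked (v ∷ vs) es →
          Linked (u ∷ v ∷ vs) (e ∷ es)

  Linked-length : ∀ {vs es} → Linked vs es → length vs ≡ suc (length es)
  Linked-length [ _ ]   = refl
  Linked-length (_ ∷ l) = cong suc (Linked-length l)

  Linked-at : ∀ {vs es} → Linked vs es → ∀ {d e i} → i < length es →
    Joins (just (at e es i)) (at d vs i) (at d vs (suc i))
  Linked-at (j ∷ _) {i = zero}  _         = j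
  Linked-at (_ ∷ l) {i = suc i} (s≤s i<) = Linked-at l i<

  Linked-closure : ∀ (p : Path a b) → All (∁ HasGap) (steps p) →
    ∀ {c e} → Joins (just e) b c → Linked (vertices p ++ c ∷ []) (pathEdges p ++ e ∷ [])
  Linked-closure [ _ ]                    []          je = je ∷ [ _ ]
  Linked-closure (_ ∷⟨ nothing , _ ⟩ _)   (gap ∷ _)   _  = contradiction refl gap
  Linked-closure (_ ∷⟨ just _ , j ⟩ [ v ]) (_ ∷ noGap) je = j ∷ Linked-closure [ v ] noGap je
  Linked-closure (_ ∷⟨ just _ , j ⟩ (v ∷⟨ ℓ , j′ ⟩ p)) (_ ∷ noGap) je =
    j ∷ Linked-closure (v ∷⟨ ℓ , j′ ⟩ p) noGap je

  toHamiltonBergeCycle : ∀ (p : Path a b) {e} → Joins (just e) b a → Spanning p →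
    Unique (usedEdges p (just e)) → All (∁ HasGap) (steps p) → HamiltonBergeCycle H
  toHamiltonBergeCycle {a} p {e} je sp u noGap = record
    { vtx = vtx ; edg = edg ; vtx-inj = vtx-inj ; edg-inj = edg-inj
    ; consec = consecutive ; closing = wrapsAround }
    where
    vs = vertices p
    es = pathEdges p ++ e ∷ []
    linked : Linked (vs ++ a ∷ []) es
    linked = Linked-closure p noGap je
    |vs|≡n : length vs ≡ n
    |vs|≡n = trans (↭-length sp) (length-tabulate (λ i → i))
    |es|≡n : length es ≡ n
    |es|≡n = suc-injective (begin
      suc (length es)        ≡⟨ Linked-length linked ⟨
      length (vs ++ a ∷ [])  ≡⟨ length-++ vs ⟩
      length vs + 1          ≡⟨ +-comm (length vs) 1 ⟩
      suc (length vs)        ≡⟨ cong suc |vs|≡n ⟩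
      suc n                  ∎)
      where open ≡-Reasoning
    i<|vs| : ∀ (i : Fin n) → toℕ i < length vs
    i<|vs| i = subst (toℕ i <_) (sym |vs|≡n) (toℕ<n i)
    i<|es| : ∀ (i : Fin n) → toℕ i < length es
    i<|es| i = subst (toℕ i <_) (sym |es|≡n) (toℕ<n i)
    vtx : Fin n → Vertex
    vtx i = at a vs (toℕ i)
    edg : Fin n → Edge
    edg i = at e es (toℕ i)
    vtx-inj : ∀ {i j} → vtx i ≡ vtx j → i ≡ j
    vtx-inj {i} {j} = toℕ-injective ∘
      at-injective a (Unique-resp-↭ (↭-sym sp) (allFin⁺ n)) (i<|vs| i) (i<|vs| j)
    edg-inj : ∀ {i j} → edg i ≡ edg j → i ≡ j
    edg-inj {i} {j} = toℕ-injective ∘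
      at-injective e (Unique-resp-↭ (++-comm (e ∷ []) (pathEdges p)) u) (i<|es| i) (i<|es| j)
    source∈ : ∀ i → vtx i ∈ edge H (edg i)
    source∈ i = subst (_∈ edge H (edg i)) (at-++ˡ a vs (i<|vs| i)) (proj₁ (Linked-at linked (i<|es| i)))
    target∈ : ∀ i → at a (vs ++ a ∷ []) (suc (toℕ i)) ∈ edge H (edg i)
    target∈ i = proj₂ (Linked-at linked (i<|es| i))
    consecutive : ∀ (i j : Fin n) → suc (toℕ i) ≡ toℕ j →
      (vtx i ∈ edge H (edg i)) × (vtx j ∈ edge H (edg i))
    consecutive i j i+1≡j = source∈ i , subst (_∈ edge H (edg i)) next (target∈ i)
      where
      next : at a (vs ++ a ∷ []) (suc (toℕ i)) ≡ vtx j
      next = trans (cong (at a (vs ++ a ∷ [])) i+1≡j) (at-++ˡ a vs (i<|vs| j))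
    wrapsAround : ∀ (i j : Fin n) → suc (toℕ i) ≡ n → toℕ j ≡ 0 →
      (vtx i ∈ edge H (edg i)) × (vtx j ∈ edge H (edg i))
    wrapsAround i j i+1≡n j≡0 = source∈ i , subst (_∈ edge H (edg i)) next (target∈ i)
      where
      next : at a (vs ++ a ∷ []) (suc (toℕ i)) ≡ vtx j
      next = begin
        at a (vs ++ a ∷ []) (suc (toℕ i))  ≡⟨ cong (at a (vs ++ a ∷ [])) i+1≡n ⟩
        at a (vs ++ a ∷ []) n              ≡⟨ cong (at a (vs ++ a ∷ [])) |vs|≡n ⟨
        at a (vs ++ a ∷ []) (length vs)    ≡⟨ at-++-length a vs ⟩
        a                                  ≡⟨ cong (λ ws → at a ws 0) (vertices≡start∷targets p) ⟨
        at a vs 0                          ≡⟨ cong (at a vs) j≡0 ⟨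
        vtx j                              ∎
        where open ≡-Reasoning

  -- Improving an arrangement with a gap

  SharesFreshEdge : List Edge → Vertex → Vertex → Set
  SharesFreshEdge U u v = Σ Edge (λ f → f ∉ˡ U × u ∈ edge H f × v ∈ edge H f)

  sharesFreshEdge? : ∀ U u v → Dec (SharesFreshEdge U u v)
  sharesFreshEdge? U u v = any? (λ f → ¬? (f ∈ˡ? U) ×-dec u ∈? edge H f ×-dec v ∈? edge H f)

  IsNeighbour : List Edge → Vertex → Vertex → Set
  IsNeighbour U v u = u ≢ v × SharesFreshEdge U v u

  isNeighbour? : ∀ U v → Decidable (IsNeighbour U v)
  isNeighbour? U v u = ¬? (u ≟ v) ×-dec sharesFreshEdge? U v u

  neighbours : List Edge → Vertex → Subset n
  neighbours U v = fromDec (isNeighbour? U v)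

  ∉-neighbours-self : ∀ U v → ¬ v ∈ neighbours U v
  ∉-neighbours-self U v v∈ = proj₁ (∈-fromDec⁻ (isNeighbour? U v) v∈) refl

  OnLink : Vertex → Maybe Edge → Set
  OnLink v = Maybe.Any (λ e → v ∈ edge H e)

  onLink? : ∀ v → Decidable (OnLink v)
  onLink? v = Maybe.dec (λ e → v ∈? edge H e)

  Switchable : List Edge → Vertex → Vertex → Step → Set
  Switchable U a b t =
    (target t ∈ neighbours U a × source t ∈ neighbours U b) ⊎
    (target t ∈ neighbours U a × OnLink b (via t)) ⊎
    (OnLink a (via t) × source t ∈ neighbours U b)

  switchable? : ∀ U a b → Decidable (Switchable U a b)
  switchable? U a b t =
    (target t ∈? neighbours U a ×-dec source t ∈? neighbours U b) ⊎-dec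
    (target t ∈? neighbours U a ×-dec onLink? b (via t)) ⊎-dec
    (onLink? a (via t) ×-dec source t ∈? neighbours U b)

  switch : ∀ (A : Path a x) ℓ j (B : Path y b) → Spanning (A ++⟨ ℓ , j ⟩ B) →
    Unique (pathEdges (A ++⟨ ℓ , j ⟩ B)) → ¬ SharesFreshEdge (pathEdges (A ++⟨ ℓ , j ⟩ B)) a b →
    Switchable (pathEdges (A ++⟨ ℓ , j ⟩ B)) a b (step x ℓ y) →
    LargerThan (length (pathEdges (A ++⟨ ℓ , j ⟩ B)))
  switch A ℓ j B sp u noCommon (inj₁ (y∈Na , x∈Nb))
    with ∈-fromDec⁻ (isNeighbour? _ _) y∈Na | ∈-fromDec⁻ (isNeighbour? _ _) x∈Nb
  ... | _ , f , f∉ , a∈f , y∈f | _ , g , g∉ , b∈g , x∈g =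
    reroute A ℓ j B sp y∈f a∈f x∈g b∈g
      ((f≢g ∷ fresh f∉) ∷ fresh g∉ ∷ Unique-catMaybes-∷⁻ ℓ R (Unique-resp-↭ old↭ u))
    where
    R = links A ++ links B
    old↭ = pathEdges-split A ℓ j B
    fresh : ∀ {h} → h ∉ˡ pathEdges (A ++⟨ ℓ , j ⟩ B) → All (h ≢_) (catMaybes R)
    fresh h∉ = ¬Any⇒All¬ _ (∉-catMaybes-∷⁻ ℓ R (h∉ ∘ ∈-resp-↭ (↭-sym old↭)))
    f≢g : f ≢ g
    f≢g refl = noCommon (f , f∉ , a∈f , b∈g)
  switch A (just e) j B sp u _ (inj₂ (inj₁ (y∈Na , Maybe.just b∈e)))
    with ∈-fromDec⁻ (isNeighbour? _ _) y∈Na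
  ... | _ , f , f∉ , a∈f , y∈f =
    reroute A (just e) j B sp y∈f a∈f (proj₁ j) b∈e
      (¬Any⇒All¬ _ (f∉ ∘ ∈-resp-↭ (↭-sym old↭)) ∷ Unique-resp-↭ old↭ u)
    where old↭ = pathEdges-split A (just e) j B
  switch A (just e) j B sp u _ (inj₂ (inj₂ (Maybe.just a∈e , x∈Nb)))
    with ∈-fromDec⁻ (isNeighbour? _ _) x∈Nb
  ... | _ , g , g∉ , b∈g , x∈g =
    reroute A (just e) j B sp (proj₂ j) a∈e x∈g b∈g
      (Unique-∷-∷ (Unique-resp-↭ old↭ u) (g∉ ∘ ∈-resp-↭ (↭-sym old↭)))
    where old↭ = pathEdges-split A (just e) j B

  module Improvement {k c : ℕ} (0<k : 0 < k) (0<cCk : 0 < c C k) (n≤2[1+c] : n ≤ 2 * suc c)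
    (uniform : Uniform (suc k) H) (minDegree : MinDegreeAtLeast H (c C k + (n ∸ 1))) where

    degree≤ : ∀ U v → degree H v ≤ ∣ neighbours U v ∣ C k + count (λ e → v ∈? edge H e) U
    degree≤ U v = begin
      degree H v                                          ≡⟨ degree≡count v ⟩
      count S? (allFin _)                                 ≡⟨ count-split S? (_∈ˡ? U) (allFin _) ⟩
      count (S? ∩? (_∈ˡ? U)) (allFin _) + count (S? ∩? ∁? (_∈ˡ? U)) (allFin _)
        ≤⟨ +-mono-≤ (count-∩-∈≤ _≟_ S? (allFin⁺ _) U) fresh ⟩
      count S? U + ∣ neighbours U v ∣ C k                 ≡⟨ +-comm (count S? U) _ ⟩
      ∣ neighbours U v ∣ C k + count S? U                 ∎
      where
      open ≤-Reasoning
      S? : Decidable (λ e → v ∈ edge H e)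
      S? e = v ∈? edge H e
      fresh : count (S? ∩? ∁? (_∈ˡ? U)) (allFin _) ≤ ∣ neighbours U v ∣ C k
      fresh = count-subsets-through≤C (S? ∩? ∁? (_∈ˡ? U)) (edge H) v (neighbours U v) k (allFin⁺ _)
        (λ _ _ eq → distinct H eq)
        (λ {e} (v∈e , e∉U) → uniform e , v∈e , λ {u} u∈e-v → ∈-fromDec⁺ (isNeighbour? U v)
          ((λ { refl → x∉p-x v (edge H e) u∈e-v }) , e , e∉U , v∈e , p─q⊆p _ _ u∈e-v))

    noSwitchable⇒⊥ : ∀ (p : Path a b) → Spanning p →
      All (∁ (Switchable (pathEdges p) a b)) (steps p) → ⊥
    noSwitchable⇒⊥ {a} {b} p sp none = two-degrees-contradiction 0<k 0<cCk l<2[1+c]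
      (degreeBound a) (degreeBound b)
      (subst₂ (λ α β → α + β ≤ l) αCount βCount (disjoint inj₁))
      (subst (λ α → α + d b ≤ l) αCount (disjoint (inj₂ ∘ inj₁)))
      (subst (λ β → d a + β ≤ l) βCount (disjoint (inj₂ ∘ inj₂)))
      where
      U = pathEdges p
      l = length (steps p)
      d : Vertex → ℕ
      d v = count (onLink? v ∘ via) (steps p)
      l<2[1+c] : l < 2 * suc c
      l<2[1+c] = subst (_≤ 2 * suc c) (sym (length-steps p sp)) n≤2[1+c]
      αCount : count ((_∈? neighbours U a) ∘ target) (steps p) ≡ ∣ neighbours U a ∣
      αCount = count-targets p sp (neighbours U a) (∉-neighbours-self U a)
      βCount : count ((_∈? neighbours U b) ∘ source) (steps p) ≡ ∣ neighbours U b ∣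
      βCount = count-sources p sp (neighbours U b) (∉-neighbours-self U b)
      disjoint : ∀ {q r} {Q : Pred Step q} {R : Pred Step r} {Q? : Decidable Q} {R? : Decidable R} →
        (∀ {t} → Q t × R t → Switchable U a b t) → count Q? (steps p) + count R? (steps p) ≤ l
      disjoint {Q? = Q?} {R?} switchable = count-disjoint Q? R? (All.map (_∘ switchable) none)
      degreeBound : ∀ v → c C k + l ≤ ∣ neighbours U v ∣ C k + d v
      degreeBound v = begin
        c C k + l                                  ≡⟨ cong (λ i → c C k + (i ∸ 1)) (length-steps p sp) ⟩
        c C k + (n ∸ 1)                            ≤⟨ minDegree v ⟩
        degree H v                                 ≤⟨ degree≤ U v ⟩
        ∣ N ∣ C k + count (λ e → v ∈? edge H e) U  ≡⟨ cong (∣ N ∣ C k +_) (count-pathEdges _ p) ⟩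
        ∣ N ∣ C k + d v                            ∎
        where
        open ≤-Reasoning
        N = neighbours U v

    improve : ∀ (p : Path a b) → Spanning p → Unique (pathEdges p) → LargerThan (length (pathEdges p))
    improve {a} {b} p sp u with sharesFreshEdge? (pathEdges p) a b
    ... | yes (f , f∉ , a∈f , b∈f) = closeGap p sp u f∉ a∈f b∈f
    ... | no noCommon with findStep (switchable? (pathEdges p) a b) p
    ...   | inj₂ none               = ⊥-elim (noSwitchable⇒⊥ p sp none)
    ...   | inj₁ (found A ℓ j B sw) = switch A ℓ j B sp u noCommon sw

    grow : ∀ s → HamiltonBergeCycle H ⊎ LargerThan (size s)
    grow (arrangement p nothing  _  sp u) = inj₂ (improve p sp u)
    grow (arrangement p (just e) je sp u) with findStep hasGap? p
    ... | inj₂ noGap                       = inj₁ (toHamiltonBergeCycle p je sp u noGap)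
    ... | inj₁ (found A nothing tt B refl) with improve (B ++⟨ just e , je ⟩ A)
                                                  (↭-trans (vertices-rotate A nothing tt B (just e) je) sp)
                                                  (Unique-resp-↭ (↭-sym (pathEdges-rotate A B je)) u)
    ...   | s , larger = inj₂ (s , subst (_< size s) (↭-length (pathEdges-rotate A B je)) larger)

    search : ∀ fuel s → n < fuel + size s → HamiltonBergeCycle H
    search zero       s n<size = contradiction (size≤n s) (<⇒≱ n<size)
    search (suc fuel) s bound with grow s
    ... | inj₁ cycle          = cycle
    ... | inj₂ (s′ , larger) = search fuel s′ (begin-strict
      n                    <⟨ bound ⟩
      suc fuel + size s    ≡⟨ +-suc fuel (size s) ⟨
      fuel + suc (size s)  ≤⟨ +-monoʳ-≤ fuel larger ⟩
      fuel + size s′       ∎)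
      where open ≤-Reasoning

  gapped : ∀ v (vs : List Vertex) → Path v (List.foldl (λ _ w → w) v vs)
  gapped v []       = [ v ]
  gapped v (w ∷ ws) = v ∷⟨ nothing , tt ⟩ gapped w ws

  vertices-gapped : ∀ v vs → vertices (gapped v vs) ≡ v ∷ vs
  vertices-gapped v []       = refl
  vertices-gapped v (w ∷ ws) = cong (v ∷_) (vertices-gapped w ws)

  pathEdges-gapped : ∀ v vs → pathEdges (gapped v vs) ≡ []
  pathEdges-gapped v []       = refl
  pathEdges-gapped v (w ∷ ws) = pathEdges-gapped w ws

  gappedArrangement : ∀ v vs → v ∷ vs ↭ allFin n → Arrangement
  gappedArrangement v vs sp = arrangement (gapped v vs) nothing tt
    (subst (_↭ allFin n) (sym (vertices-gapped v vs)) sp)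
    (subst Unique (sym (pathEdges-gapped v vs)) [])

hamiltonBergeCycle : ∀ {n} (H : Hypergraph (suc n)) {k c} → 0 < k → k ≤ c → suc n ≤ 2 * suc c →
  Uniform (suc k) H → MinDegreeAtLeast H (c C k + n) → HamiltonBergeCycle H
hamiltonBergeCycle {n} H 0<k k≤c n≤2[1+c] uniform minDegree =
  search (suc (suc n)) (gappedArrangement zero (tabulate suc) ↭-refl) (m≤m+n (suc (suc n)) _)
  where
  open Arrangements H
  open Improvement 0<k (k≤n⇒0<nCk k≤c) n≤2[1+c] uniform minDegree

proposition1p2 : (r n : ℕ) → 3 ≤ r → 2 * r ∸ 2 < n →
    (H : Hypergraph n) → Uniform r H →
    MinDegreeAtLeast H (((ceilHalf n ∸ 1) C (r ∸ 1)) + (n ∸ 1)) →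
    HamiltonBergeCycle H
proposition1p2 (suc k) (suc n) 3≤r 2r∸2<n H uniform minDegree =
  hamiltonBergeCycle H 0<k (∸-monoˡ-≤ 1 r≤⌈n/2⌉) n≤2[1+c] uniform minDegree
  where
  0<k : 0 < k
  0<k = ≤-trans (s≤s z≤n) (≤-pred 3≤r)
  r≤⌈n/2⌉ : suc k ≤ ceilHalf (suc n)
  r≤⌈n/2⌉ = 2r∸2<n⇒r≤⌈n/2⌉ 2r∸2<n
  n≤2[1+c] : suc n ≤ 2 * suc (ceilHalf (suc n) ∸ 1)
  n≤2[1+c] = subst (λ h → suc n ≤ 2 * h) (sym (m+[n∸m]≡n (≤-trans (s≤s z≤n) r≤⌈n/2⌉)))
    (n≤2⌈n/2⌉ (suc n))
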